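{- Let $m,n\in\mathbb{N}$, let $a_1,\ldots,a_m\in\mathbb{N}_0$ with $a_1\ge a_2\ge\cdots\ge a_m$ and $a_1\ne 0$, let $A(x_1,\ldots,x_m)=\sum_{i=1}^m a_ix_i$ and $a=\sum_{i=1}^m a_i^2$. If $T\in\mathscr{S}_{m,A}(n)$, then there exist $\alpha_i,\beta_i\in\mathbb{Z}$, $1\le i\le m$, with $$aX^2+2TXY+nY^2=\sum_{i=1}^m(\alpha_iX+\beta_iY)^2\quad\text{in }\mathbb{Z}[X,Y].$$ The converse holds if in addition $P_m(a)=1$.
   Context: $\mathbb{N}$ denotes the positive integers and $\mathbb{N}_0$ the nonnegative integers. $\mathscr{S}_{m,A}(n)$ denotes the set of all $T\in\mathbb{Z}$ for which there exist $x_1,\ldots,x_m\in\mathbb{Z}$ with $a_1x_1+\cdots+a_mx_m=T$ and $x_1^2+\cdots+x_m^2=n$. For $k,m\in\mathbb{N}$, $P_m(k)$ is the number of tuples $(c_1,\ldots,c_m)\in\mathbb{N}_0^m$ with $c_1\ge c_2\ge\cdots\ge c_m$ and $\sum_{i=1}^m c_i^2=k$. -}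

module Defs where

open import Data.Nat as ℕ using (ℕ; zero; suc)
import Data.Nat.Properties as ℕP
open import Data.Integer as ℤ using (ℤ; +_)
open import Data.Fin as Fin using (Fin; zero; suc)
import Data.Fin.Properties as FinP
open import Data.Vec as Vec using (Vec; []; _∷_; lookup)
open import Data.List as List using (List; [_]; concatMap; filter; length; upTo)
open import Data.Product using (Σ; _×_; _,_; ∃)
open import Relation.Nullary using (Dec)
open import Relation.Nullary.Decidable using (_×-dec_; _→-dec_)
open import Relation.Binary.PropositionalEquality using (_≡_)

sumℕ : (m : ℕ) → (Fin m → ℕ) → ℕ
sumℕ zero    f = 0
sumℕ (suc m) f = f zero ℕ.+ sumℕ m (λ i → f (suc i))

sumℤ : (m : ℕ) → (Fin m → ℤ) → ℤ
sumℤ zero    f = + 0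
sumℤ (suc m) f = f zero ℤ.+ sumℤ m (λ i → f (suc i))

NonIncreasing : {m : ℕ} → (Fin m → ℕ) → Set
NonIncreasing {m} c = (i j : Fin m) → i Fin.≤ j → c j ℕ.≤ c i

nonIncreasing? : {m : ℕ} → (c : Fin m → ℕ) → Dec (NonIncreasing c)
nonIncreasing? c = FinP.all? λ i → FinP.all? λ j →
  (i Fin.≤? j) →-dec (c j ℕ.≤? c i)

InS : (m : ℕ) → (Fin m → ℕ) → (n : ℕ) → ℤ → Set
InS m a n T = Σ (Fin m → ℤ) λ x →
  (sumℤ m (λ i → + (a i) ℤ.* x i) ≡ T) × (sumℤ m (λ i → x i ℤ.* x i) ≡ + n)

allVecs : (m b : ℕ) → List (Vec ℕ m)
allVecs zero    b = [ [] ]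
allVecs (suc m) b = concatMap (λ x → List.map (x ∷_) (allVecs m b)) (upTo (suc b))

IsPTuple : {m : ℕ} → ℕ → (Fin m → ℕ) → Set
IsPTuple {m} k c = NonIncreasing c × (sumℕ m (λ i → c i ℕ.* c i) ≡ k)

isPTuple? : {m : ℕ} → (k : ℕ) → (c : Fin m → ℕ) → Dec (IsPTuple k c)
isPTuple? {m} k c = nonIncreasing? c ×-dec (sumℕ m (λ i → c i ℕ.* c i) ℕ.≟ k)

-- P_m(k): number of (c₁,…,c_m) ∈ ℕ₀^m, c₁ ≥ ⋯ ≥ c_m, Σ cᵢ² = k.
-- Every such tuple has cᵢ ≤ cᵢ² ≤ k, so enumerating {0,…,k}^m is exhaustive.
P : (m k : ℕ) → ℕ
P m k = length (filter (λ v → isPTuple? k (lookup v)) (allVecs m k))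

-- Binary quadratic forms uX² + vXY + wY² in ℤ[X,Y], represented by their
-- coefficient triple (u , v , w); equality of triples = equality of polynomials.
BQF : Set
BQF = ℤ × ℤ × ℤ

_⊕_ : BQF → BQF → BQF
(u , v , w) ⊕ (u' , v' , w') = (u ℤ.+ u' , v ℤ.+ v' , w ℤ.+ w')

zeroF : BQF
zeroF = (+ 0 , + 0 , + 0)

-- (αX + βY)² = α²X² + 2αβXY + β²Y²
sqLin : ℤ → ℤ → BQF
sqLin α β = (α ℤ.* α , + 2 ℤ.* (α ℤ.* β) , β ℤ.* β)

sumF : (m : ℕ) → (Fin m → BQF) → BQF
sumF zero    f = zeroF
sumF (suc m) f = f zero ⊕ sumF m (λ i → f (suc i))

form : ℕ → ℤ → ℕ → BQF
form a T n = (+ a , + 2 ℤ.* T , + n)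

-- Comparing coefficients, aX² + 2TXY + nY² = Σᵢ (αᵢX + βᵢY)² says exactly
-- Σ αᵢ² = a, Σ αᵢβᵢ = T and Σ βᵢ² = n.  Hence a point x with A(x) = T and
-- |x|² = n yields the representation αᵢ = aᵢ, βᵢ = xᵢ.  Conversely, given
-- (α, β), reorder the indices by a permutation σ so that |α_{σ(i)}| is
-- non-increasing and flip the signs of the βᵢ together with those of the αᵢ.
-- The resulting |α_σ| is a non-increasing tuple with square sum a, as is a
-- itself; when P_m(a) = 1 the two coincide, and the sign-adjusted β_σ is the
-- required point of 𝒮_{m,A}(n).
module Submission where

open import Defs
open import Data.Nat using (ℕ; _≤_; _≥_)
open import Data.Integer using (ℤ)
open import Data.Fin using (Fin; fromℕ<)
import Data.Fin
open import Data.Product using (Σ; _×_)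
open import Relation.Binary.PropositionalEquality using (_≡_; _≢_)

open import Data.Nat as ℕ using (zero; suc; z≤n; s≤s; _≤?_)
import Data.Nat.Properties as ℕP
open import Data.Integer as ℤ using (+_; -[1+_]; -_; ∣_∣)
import Data.Integer.Properties as ℤP
open import Data.Fin using (zero; suc)
open import Data.Fin.Permutation as Perm using (Permutation; _⟨$⟩ʳ_; lift₀; transpose; _∘ₚ_)
open import Data.Vec using (lookup; tabulate)
open import Data.Vec.Properties using (lookup∘tabulate)
open import Data.List as List using (List; []; _∷_; filter; length)
open import Data.List.Membership.Propositional using (_∈_)
open import Data.List.Membership.Propositional.Properties
  using (∈-filter⁺; ∈-concatMap⁺; ∈-map⁺; ∈-upTo⁺)
open import Data.List.Relation.Unary.Any as Any using (here)
open import Data.Product using (_,_; proj₁; proj₂)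
open import Function using (_∘_; _⇔_; mk⇔)
open import Function.Bundles using (Equivalence)
open import Relation.Binary.PropositionalEquality
  using (refl; sym; trans; cong; cong₂; subst; subst₂; _≗_; module ≡-Reasoning)
open import Relation.Nullary using (yes; no)
import Algebra.Properties.CommutativeMonoid.Sum ℤP.+-0-commutativeMonoid as ℤSum

sumℕ-cong : ∀ m {f g : Fin m → ℕ} → f ≗ g → sumℕ m f ≡ sumℕ m g
sumℕ-cong zero    e = refl
sumℕ-cong (suc m) e = cong₂ ℕ._+_ (e zero) (sumℕ-cong m (e ∘ suc))

sumℤ-cong : ∀ m {f g : Fin m → ℤ} → f ≗ g → sumℤ m f ≡ sumℤ m g
sumℤ-cong zero    e = refl
sumℤ-cong (suc m) e = cong₂ ℤ._+_ (e zero) (sumℤ-cong m (e ∘ suc))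

sum-cast : ∀ m (f : Fin m → ℕ) → + sumℕ m f ≡ sumℤ m (+_ ∘ f)
sum-cast zero    f = refl
sum-cast (suc m) f = trans (ℤP.pos-+ (f zero) _) (cong (ℤ._+_ (+ f zero)) (sum-cast m (f ∘ suc)))

term≤sumℕ : ∀ m (f : Fin m → ℕ) i → f i ≤ sumℕ m f
term≤sumℕ (suc m) f zero    = ℕP.m≤m+n _ _
term≤sumℕ (suc m) f (suc i) = ℕP.≤-trans (term≤sumℕ m (f ∘ suc) i) (ℕP.m≤n+m _ _)

-- sumℤ is the library's monoid sum, so permutation invariance is inherited.
sumℤ≡sum : ∀ m (f : Fin m → ℤ) → sumℤ m f ≡ ℤSum.sum f
sumℤ≡sum zero    f = refl
sumℤ≡sum (suc m) f = cong (ℤ._+_ (f zero)) (sumℤ≡sum m (f ∘ suc))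

sumℤ-permute : ∀ m (f : Fin m → ℤ) (σ : Permutation m m) →
  sumℤ m (f ∘ (σ ⟨$⟩ʳ_)) ≡ sumℤ m f
sumℤ-permute m f σ = begin
  sumℤ m (f ∘ (σ ⟨$⟩ʳ_)) ≡⟨ sumℤ≡sum m _ ⟩
  ℤSum.sum (f ∘ (σ ⟨$⟩ʳ_)) ≡⟨ sym (ℤSum.sum-permute f σ) ⟩
  ℤSum.sum f               ≡⟨ sym (sumℤ≡sum m f) ⟩
  sumℤ m f                 ∎
  where open ≡-Reasoning

sumF-sqLin : ∀ m (α β : Fin m → ℤ) → sumF m (λ i → sqLin (α i) (β i)) ≡
  (sumℤ m (λ i → α i ℤ.* α i) , + 2 ℤ.* sumℤ m (λ i → α i ℤ.* β i) , sumℤ m (λ i → β i ℤ.* β i))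
sumF-sqLin zero    α β = refl
sumF-sqLin (suc m) α β rewrite sumF-sqLin m (α ∘ suc) (β ∘ suc) =
  cong (λ v → (_ , v , _)) (sym (ℤP.*-distribˡ-+ (+ 2) (α zero ℤ.* β zero) _))

Gram : ∀ m → ℕ → ℤ → ℕ → (α β : Fin m → ℤ) → Set
Gram m a T n α β =
  (+ a ≡ sumℤ m (λ i → α i ℤ.* α i)) × (T ≡ sumℤ m (λ i → α i ℤ.* β i)) × (+ n ≡ sumℤ m (λ i → β i ℤ.* β i))

form≡sumF⇔Gram : ∀ m a T n (α β : Fin m → ℤ) →
  (form a T n ≡ sumF m (λ i → sqLin (α i) (β i))) ⇔ Gram m a T n α β
form≡sumF⇔Gram m a T n α β = mk⇔ toGram fromGram
  where
  toGram : form a T n ≡ sumF m (λ i → sqLin (α i) (β i)) → Gram m a T n α β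
  toGram e = cong proj₁ coeffs , ℤP.*-cancelˡ-≡ (+ 2) _ _ (cong (proj₁ ∘ proj₂) coeffs) , cong (proj₂ ∘ proj₂) coeffs
    where coeffs = trans e (sumF-sqLin m α β)

  fromGram : Gram m a T n α β → form a T n ≡ sumF m (λ i → sqLin (α i) (β i))
  fromGram (a≡ , T≡ , n≡) =
    trans (cong₂ (λ u v → (u , v)) a≡ (cong₂ (λ u v → (u , v)) (cong (+ 2 ℤ.*_) T≡) n≡))
          (sym (sumF-sqLin m α β))

argmax : ∀ {m} (k : Fin (suc m) → ℕ) → Σ (Fin (suc m)) λ i → ∀ j → k j ≤ k i
argmax {zero}  k = zero , λ { zero → ℕP.≤-refl }
argmax {suc m} k with argmax (k ∘ suc)
... | i , max with k (suc i) ≤? k zero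
...   | yes le = zero  , λ { zero → ℕP.≤-refl ; (suc j) → ℕP.≤-trans (max j) le }
...   | no gt  = suc i , λ { zero → ℕP.≰⇒≥ gt ; (suc j) → max j }

sortingPermutation : ∀ m (k : Fin m → ℕ) →
  Σ (Permutation m m) λ σ → NonIncreasing (k ∘ (σ ⟨$⟩ʳ_))
sortingPermutation zero    k = Perm.id , λ ()
sortingPermutation (suc m) k = σ , sorted
  where
  top : Σ (Fin (suc m)) λ i → ∀ j → k j ≤ k i
  top = argmax k

  τ : Permutation (suc m) (suc m)
  τ = transpose zero (proj₁ top)

  rest : Σ (Permutation m m) λ ρ → NonIncreasing (λ j → k (τ ⟨$⟩ʳ suc (ρ ⟨$⟩ʳ j)))
  rest = sortingPermutation m (λ j → k (τ ⟨$⟩ʳ suc j))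

  σ : Permutation (suc m) (suc m)
  σ = lift₀ (proj₁ rest) ∘ₚ τ

  sorted : NonIncreasing (k ∘ (σ ⟨$⟩ʳ_))
  sorted zero    j       _       = proj₂ top (σ ⟨$⟩ʳ j)
  sorted (suc i) (suc j) (s≤s p) = proj₂ rest i j p

IsPTuple-resp : ∀ {m} k {c d : Fin m → ℕ} → c ≗ d → IsPTuple k c → IsPTuple k d
IsPTuple-resp {m} k e (ni , s) =
  (λ i j p → subst₂ _≤_ (e j) (e i) (ni i j p)) ,
  trans (sumℕ-cong m (λ i → sym (cong₂ ℕ._*_ (e i) (e i)))) s

n≤n*n : ∀ n → n ≤ n ℕ.* n
n≤n*n zero    = z≤n
n≤n*n (suc n) = ℕP.m≤m*n (suc n) (suc n)

ptuple-bounded : ∀ {m} k (c : Fin m → ℕ) → IsPTuple k c → ∀ i → c i ≤ k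
ptuple-bounded {m} k c (_ , s) i =
  subst (c i ≤_) s (ℕP.≤-trans (n≤n*n (c i)) (term≤sumℕ m (λ j → c j ℕ.* c j) i))

∈-allVecs : ∀ m b (c : Fin m → ℕ) → (∀ i → c i ≤ b) → tabulate c ∈ allVecs m b
∈-allVecs zero    b c h = here refl
∈-allVecs (suc m) b c h =
  ∈-concatMap⁺ (λ x → List.map (x Data.Vec.∷_) (allVecs m b))
    (Any.map (λ { refl → ∈-map⁺ (c zero Data.Vec.∷_) (∈-allVecs m b (c ∘ suc) (h ∘ suc)) })
      (∈-upTo⁺ (s≤s (h zero))))

∈-PList : ∀ m k (c : Fin m → ℕ) → IsPTuple k c →
  tabulate c ∈ filter (λ v → isPTuple? k (lookup v)) (allVecs m k)
∈-PList m k c ip = ∈-filter⁺ (λ v → isPTuple? k (lookup v))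
  (∈-allVecs m k c (ptuple-bounded k c ip))
  (IsPTuple-resp k (λ i → sym (lookup∘tabulate c i)) ip)

∈-length-one : ∀ {A : Set} {l : List A} {u v : A} → length l ≡ 1 → u ∈ l → v ∈ l → u ≡ v
∈-length-one {l = _ ∷ []} _ (here refl) (here refl) = refl

ptuple-unique : ∀ m k → P m k ≡ 1 → (c d : Fin m → ℕ) → IsPTuple k c → IsPTuple k d → c ≗ d
ptuple-unique m k P≡1 c d ic id i = begin
  c i                   ≡⟨ sym (lookup∘tabulate c i) ⟩
  lookup (tabulate c) i ≡⟨ cong (λ v → lookup v i) (∈-length-one P≡1 (∈-PList m k c ic) (∈-PList m k d id)) ⟩
  lookup (tabulate d) i ≡⟨ lookup∘tabulate d i ⟩
  d i                   ∎
  where open ≡-Reasoning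

alignSign : ℤ → ℤ → ℤ
alignSign (+ _)    β = β
alignSign -[1+ _ ] β = - β

abs-square : ∀ α → + (∣ α ∣ ℕ.* ∣ α ∣) ≡ α ℤ.* α
abs-square (+ k)    = ℤP.pos-* k k
abs-square -[1+ k ] = refl

abs-alignSign : ∀ α β → + ∣ α ∣ ℤ.* alignSign α β ≡ α ℤ.* β
abs-alignSign (+ k)    β = refl
abs-alignSign -[1+ k ] β = trans (sym (ℤP.neg-distribʳ-* (+ suc k) β)) (ℤP.neg-distribˡ-* (+ suc k) β)

alignSign-square : ∀ α β → alignSign α β ℤ.* alignSign α β ≡ β ℤ.* β
alignSign-square (+ k)    β = refl
alignSign-square -[1+ k ] β = begin
  - β ℤ.* - β    ≡⟨ sym (ℤP.neg-distribˡ-* β (- β)) ⟩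
  - (β ℤ.* - β)  ≡⟨ cong -_ (sym (ℤP.neg-distribʳ-* β β)) ⟩
  - - (β ℤ.* β)  ≡⟨ ℤP.neg-involutive (β ℤ.* β) ⟩
  β ℤ.* β        ∎
  where open ≡-Reasoning

Representation : ∀ m → ℕ → ℤ → ℕ → Set
Representation m a T n = Σ (Fin m → ℤ) λ α → Σ (Fin m → ℤ) λ β →
  form a T n ≡ sumF m (λ i → sqLin (α i) (β i))

forward : ∀ m n (a : Fin m → ℕ) T → InS m a n T →
  Representation m (sumℕ m (λ i → a i ℕ.* a i)) T n
forward m n a T (x , A[x]≡T , |x|²≡n) =
  α , x , Equivalence.from (form≡sumF⇔Gram m _ T n α x) (a²≡ , sym A[x]≡T , sym |x|²≡n)
  where
  α : Fin m → ℤ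
  α i = + a i

  a²≡ : + sumℕ m (λ i → a i ℕ.* a i) ≡ sumℤ m (λ i → α i ℤ.* α i)
  a²≡ = trans (sum-cast m _) (sumℤ-cong m (λ i → ℤP.pos-* (a i) (a i)))

converse : ∀ m n (a : Fin m → ℕ) → NonIncreasing a → ∀ T →
  P m (sumℕ m (λ i → a i ℕ.* a i)) ≡ 1 →
  Representation m (sumℕ m (λ i → a i ℕ.* a i)) T n → InS m a n T
converse m n a ni T P≡1 (α , β , rep) = y , A[y]≡T , |y|²≡n
  where
  K : ℕ
  K = sumℕ m (λ i → a i ℕ.* a i)

  gram : Gram m K T n α β
  gram = Equivalence.to (form≡sumF⇔Gram m K T n α β) rep

  sorting : Σ (Permutation m m) λ σ → NonIncreasing (λ i → ∣ α (σ ⟨$⟩ʳ i) ∣)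
  sorting = sortingPermutation m (∣_∣ ∘ α)

  σ : Permutation m m
  σ = proj₁ sorting

  c : Fin m → ℕ
  c i = ∣ α (σ ⟨$⟩ʳ i) ∣

  y : Fin m → ℤ
  y i = alignSign (α (σ ⟨$⟩ʳ i)) (β (σ ⟨$⟩ʳ i))

  rearranged : (g : ℤ → ℤ → ℤ) (h : Fin m → ℤ) → (∀ i → g (α i) (β i) ≡ h i) →
    sumℤ m (λ i → g (α (σ ⟨$⟩ʳ i)) (β (σ ⟨$⟩ʳ i))) ≡ sumℤ m h
  rearranged g h e = trans (sumℤ-cong m (e ∘ (σ ⟨$⟩ʳ_))) (sumℤ-permute m h σ)

  c-ptuple : IsPTuple K c
  c-ptuple = proj₂ sorting , ℤP.+-injective (begin
    + sumℕ m (λ i → c i ℕ.* c i)              ≡⟨ sum-cast m _ ⟩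
    sumℤ m (λ i → + (c i ℕ.* c i))            ≡⟨ rearranged (λ α _ → + (∣ α ∣ ℕ.* ∣ α ∣)) _ (λ i → abs-square (α i)) ⟩
    sumℤ m (λ i → α i ℤ.* α i)                ≡⟨ sym (proj₁ gram) ⟩
    + K                                       ∎)
    where open ≡-Reasoning

  c≗a : c ≗ a
  c≗a = ptuple-unique m K P≡1 c a c-ptuple (ni , refl)

  A[y]≡T : sumℤ m (λ i → + a i ℤ.* y i) ≡ T
  A[y]≡T = begin
    sumℤ m (λ i → + a i ℤ.* y i)  ≡⟨ sumℤ-cong m (λ i → cong (λ z → + z ℤ.* y i) (sym (c≗a i))) ⟩
    sumℤ m (λ i → + c i ℤ.* y i)  ≡⟨ rearranged (λ α β → + ∣ α ∣ ℤ.* alignSign α β) _ (λ i → abs-alignSign (α i) (β i)) ⟩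
    sumℤ m (λ i → α i ℤ.* β i)    ≡⟨ sym (proj₁ (proj₂ gram)) ⟩
    T                             ∎
    where open ≡-Reasoning

  |y|²≡n : sumℤ m (λ i → y i ℤ.* y i) ≡ + n
  |y|²≡n = trans (rearranged (λ α β → alignSign α β ℤ.* alignSign α β) _ (λ i → alignSign-square (α i) (β i)))
                 (sym (proj₂ (proj₂ gram)))

proposition5p3 : (m n : ℕ) → (m≥1 : 1 ≤ m) → 1 ≤ n →
    (a : Fin m → ℕ) → ((i j : Fin m) → i Data.Fin.≤ j → a i ≥ a j) →
    a (fromℕ< m≥1) ≢ 0 →
    (T : ℤ) →
    (InS m a n T →
      Σ (Fin m → ℤ) λ α → Σ (Fin m → ℤ) λ β →
        form (sumℕ m (λ i → a i Data.Nat.* a i)) T n ≡ sumF m (λ i → sqLin (α i) (β i)))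
    ×
    (P m (sumℕ m (λ i → a i Data.Nat.* a i)) ≡ 1 →
      (Σ (Fin m → ℤ) λ α → Σ (Fin m → ℤ) λ β →
        form (sumℕ m (λ i → a i Data.Nat.* a i)) T n ≡ sumF m (λ i → sqLin (α i) (β i))) →
      InS m a n T)
proposition5p3 m n _ _ a nonIncreasing _ T = forward m n a T , converse m n a nonIncreasing T
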